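{- Let $\mathbb{M}$ be the set of Motzkin numbers of the second kind, enumerated increasingly as $m_0<m_1<m_2<\cdots$, and for $n\ge1$ let $\mathbb{M}_n$ be the set of elements of $\mathbb{M}$ whose base-3 representation has exactly $n$ digits. Then for every $n\ge 2$, the minimal element of $\mathbb{M}_n$ is $\min\mathbb{M}_n=3^{n-1}+2$, and it is the element $m_{M_{n-1}}$, i.e. its index in the enumeration is $M_{n-1}$, where $M_j$ denotes the $j$-th Motzkin number.
   Context: A Motzkin number of the second kind is a natural number $m$ whose base-3 representation (written without leading zeros, and as the single digit $0$ when $m=0$) contains equally many digits $1$ and $2$, and in which every prefix contains at least as many digits $1$ as digits $2$. The Motzkin number $M_j$ ($j\ge0$) is the number of strings of length $j$ over the alphabet $\{0,1,2\}$ having equally many $1$'s and $2$'s and in which every prefix has at least as many $1$'s as $2$'s (so $M_0=1,M_1=1,M_2=2,M_3=4,M_4=9,\dots$). The index of $m_i$ is $i$ (indices start at $0$, with $m_0=0$). -}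

module Defs where

open import Data.Nat using (ℕ; zero; suc; _+_; _∸_; _^_; _≤_; _%_; _/_; _≡ᵇ_; _≤ᵇ_)
open import Data.Bool using (Bool; true; false; _∧_)
open import Data.List using (List; []; _∷_; reverse; length; filterᵇ; upTo; inits; concatMap; map)
open import Relation.Binary.PropositionalEquality using (_≡_)
open import Data.Product using (_×_)

-- Little-endian base-3 digits of m, with fuel f (fuel ≥ m suffices).
digitsLE : ℕ → ℕ → List ℕ
digitsLE zero    _       = []
digitsLE (suc f) zero    = []
digitsLE (suc f) (suc m) = (suc m % 3) ∷ digitsLE f (suc m / 3)

-- Base-3 representation, most significant digit first, no leading zeros;
-- 0 is represented by the single digit 0.
base3 : ℕ → List ℕ
base3 zero    = 0 ∷ []
base3 (suc m) = reverse (digitsLE (suc m) (suc m))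

count : ℕ → List ℕ → ℕ
count d []       = 0
count d (x ∷ xs) = if' (x ≡ᵇ d) (suc (count d xs)) (count d xs)
  where
  if' : Bool → ℕ → ℕ → ℕ
  if' true  a _ = a
  if' false _ b = b

allᵇ : {A : Set} → (A → Bool) → List A → Bool
allᵇ p []       = true
allᵇ p (x ∷ xs) = p x ∧ allᵇ p xs

isMotzkinWord : List ℕ → Bool
isMotzkinWord w =
  (count 1 w ≡ᵇ count 2 w) ∧ allᵇ (λ p → count 2 p ≤ᵇ count 1 p) (inits w)

isM : ℕ → Bool
isM m = isMotzkinWord (base3 m)

InM : ℕ → Set
InM m = isM m ≡ true

words : ℕ → List (List ℕ)
words zero    = [] ∷ []
words (suc j) = concatMap (λ w → (0 ∷ w) ∷ (1 ∷ w) ∷ (2 ∷ w) ∷ []) (words j)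

motzkin : ℕ → ℕ
motzkin j = length (filterᵇ isMotzkinWord (words j))

-- index of m in the increasing enumeration m_0 < m_1 < ... of 𝕄:
-- the number of elements of 𝕄 strictly below m.
index : ℕ → ℕ
index m = length (filterᵇ isM (upTo m))

InMn : ℕ → ℕ → Set
InMn n m = InM m × length (base3 m) ≡ n

IsMinMn : ℕ → ℕ → Set
IsMinMn n m = InMn n m × (∀ k → InMn n k → m ≤ k)

-- Padding base-3 digits with leading zeros identifies the numbers below 3^N with the
-- words of length N; counts over all words of length N are invariant under reversing
-- the words, which reconciles the two digit orders, and leading zeros affect neither
-- digit counts nor prefix conditions. So exactly M_N elements of 𝕄 lie below 3^N.
-- A number with n digits is at least 3^(n-1), and 3^(n-1), 3^(n-1) + 1, 3^(n-1) + 2 are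
-- written 10…00, 10…01, 10…02, of which only the last is a Motzkin word.
module Submission where

open import Data.Bool using (Bool; true; false; _∧_)
open import Data.List using (List; []; _∷_; _++_; _∷ʳ_; length; reverse; replicate; concatMap; filterᵇ; upTo; inits; map)
open import Data.List.Properties using (length-++; length-replicate; length-reverse; reverse-++; unfold-reverse; upTo-∷ʳ; ++-identityʳ)
open import Data.Nat
open import Data.Nat.DivMod
open import Data.Nat.Divisibility using (n∣m*n)
open import Data.Nat.Properties
open import Data.Nat.Tactic.RingSolver using (solve-∀)
open import Data.Product using (_×_; _,_; ∃-syntax; map₂)
open import Function using (_∘_)
open import Relation.Binary.PropositionalEquality

open import Defs

private
  variable
    A B : Set

𝟙 : Bool → ℕ
𝟙 true  = 1
𝟙 false = 0

countᵇ : (A → Bool) → List A → ℕ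
countᵇ p xs = length (filterᵇ p xs)

countᵇ-∷ : ∀ (p : A → Bool) x xs → countᵇ p (x ∷ xs) ≡ 𝟙 (p x) + countᵇ p xs
countᵇ-∷ p x xs with p x
... | true  = refl
... | false = refl

countᵇ-++ : ∀ (p : A → Bool) xs ys → countᵇ p (xs ++ ys) ≡ countᵇ p xs + countᵇ p ys
countᵇ-++ p []       ys = refl
countᵇ-++ p (x ∷ xs) ys = begin
  countᵇ p (x ∷ xs ++ ys)               ≡⟨ countᵇ-∷ p x (xs ++ ys) ⟩
  𝟙 (p x) + countᵇ p (xs ++ ys)         ≡⟨ cong (𝟙 (p x) +_) (countᵇ-++ p xs ys) ⟩
  𝟙 (p x) + (countᵇ p xs + countᵇ p ys) ≡⟨ sym (+-assoc (𝟙 (p x)) _ _) ⟩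
  𝟙 (p x) + countᵇ p xs + countᵇ p ys   ≡⟨ cong (_+ countᵇ p ys) (sym (countᵇ-∷ p x xs)) ⟩
  countᵇ p (x ∷ xs) + countᵇ p ys       ∎
  where open ≡-Reasoning

countᵇ-cong : ∀ {p q : A → Bool} → (∀ x → p x ≡ q x) → ∀ xs → countᵇ p xs ≡ countᵇ q xs
countᵇ-cong e []       = refl
countᵇ-cong {p = p} {q} e (x ∷ xs) = begin
  countᵇ p (x ∷ xs)     ≡⟨ countᵇ-∷ p x xs ⟩
  𝟙 (p x) + countᵇ p xs ≡⟨ cong₂ _+_ (cong 𝟙 (e x)) (countᵇ-cong e xs) ⟩
  𝟙 (q x) + countᵇ q xs ≡⟨ sym (countᵇ-∷ q x xs) ⟩
  countᵇ q (x ∷ xs)     ∎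
  where open ≡-Reasoning

[m+kn]%n≡m : ∀ m k n .{{_ : NonZero n}} → m < n → (m + k * n) % n ≡ m
[m+kn]%n≡m m k n m<n = trans ([m+kn]%n≡m%n m k n) (m<n⇒m%n≡m m<n)

[m+kn]/n≡k : ∀ m k n .{{_ : NonZero n}} → m < n → (m + k * n) / n ≡ k
[m+kn]/n≡k m k n m<n = trans (+-distrib-/-∣ʳ m (n∣m*n k)) (cong₂ _+_ (m<n⇒m/n≡0 m<n) (m*n/n≡m k n))

3^n<3^[1+n] : ∀ n → 3 ^ n < 3 ^ suc n
3^n<3^[1+n] n = ^-monoʳ-< 3 (s<s z<s) (n<1+n n)

allᵇ-map : ∀ (p : B → Bool) (f : A → B) xs → allᵇ p (map f xs) ≡ allᵇ (p ∘ f) xs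
allᵇ-map p f []       = refl
allᵇ-map p f (x ∷ xs) = cong (p (f x) ∧_) (allᵇ-map p f xs)

replicate-∷ʳ : ∀ k (x : A) → replicate k x ∷ʳ x ≡ x ∷ replicate k x
replicate-∷ʳ zero    x = refl
replicate-∷ʳ (suc k) x = cong (x ∷_) (replicate-∷ʳ k x)

reverse-replicate : ∀ k (x : A) → reverse (replicate k x) ≡ replicate k x
reverse-replicate zero    x = refl
reverse-replicate (suc k) x = begin
  reverse (x ∷ replicate k x)  ≡⟨ unfold-reverse x (replicate k x) ⟩
  reverse (replicate k x) ∷ʳ x ≡⟨ cong (_∷ʳ x) (reverse-replicate k x) ⟩
  replicate k x ∷ʳ x           ≡⟨ replicate-∷ʳ k x ⟩
  x ∷ replicate k x            ∎
  where open ≡-Reasoning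

Σ₃ : (ℕ → ℕ) → ℕ
Σ₃ g = g 0 + g 1 + g 2

Σ₃-cong : ∀ {g h : ℕ → ℕ} → (∀ d → d < 3 → g d ≡ h d) → Σ₃ g ≡ Σ₃ h
Σ₃-cong e = cong₂ _+_ (cong₂ _+_ (e 0 z<s) (e 1 (s<s z<s))) (e 2 (s<s (s<s z<s)))

Σ₃-distrib-+ : ∀ (g h : ℕ → ℕ) → Σ₃ (λ d → g d + h d) ≡ Σ₃ g + Σ₃ h
Σ₃-distrib-+ g h = interchange (g 0) (g 1) (g 2) (h 0) (h 1) (h 2)
  where
  interchange : ∀ a b c x y z → a + x + (b + y) + (c + z) ≡ a + b + c + (x + y + z)
  interchange = solve-∀

Σ₃-swap : ∀ (c : ℕ → ℕ → ℕ) → Σ₃ (λ e → Σ₃ (c e)) ≡ Σ₃ (λ d → Σ₃ (λ e → c e d))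
Σ₃-swap c = transpose (c 0 0) (c 0 1) (c 0 2) (c 1 0) (c 1 1) (c 1 2) (c 2 0) (c 2 1) (c 2 2)
  where
  transpose : ∀ a₀ a₁ a₂ b₀ b₁ b₂ c₀ c₁ c₂ →
    a₀ + a₁ + a₂ + (b₀ + b₁ + b₂) + (c₀ + c₁ + c₂) ≡ a₀ + b₀ + c₀ + (a₁ + b₁ + c₁) + (a₂ + b₂ + c₂)
  transpose = solve-∀

#below : (ℕ → Bool) → ℕ → ℕ
#below p zero    = 0
#below p (suc n) = #below p n + 𝟙 (p n)

countᵇ-upTo : ∀ p n → countᵇ p (upTo n) ≡ #below p n
countᵇ-upTo p zero    = refl
countᵇ-upTo p (suc n) = begin
  countᵇ p (upTo (suc n))               ≡⟨ cong (countᵇ p) (sym (upTo-∷ʳ n)) ⟩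
  countᵇ p (upTo n ∷ʳ n)                ≡⟨ countᵇ-++ p (upTo n) (n ∷ []) ⟩
  countᵇ p (upTo n) + countᵇ p (n ∷ []) ≡⟨ cong₂ _+_ (countᵇ-upTo p n) (trans (countᵇ-∷ p n []) (+-identityʳ _)) ⟩
  #below p n + 𝟙 (p n)                  ∎
  where open ≡-Reasoning

#below-cong : ∀ {p q} n → (∀ m → m < n → p m ≡ q m) → #below p n ≡ #below q n
#below-cong zero    e = refl
#below-cong (suc n) e =
  cong₂ _+_ (#below-cong n (λ m m<n → e m (m<n⇒m<1+n m<n))) (cong 𝟙 (e n (n<1+n n)))

#below-*3 : ∀ p n → #below p (n * 3) ≡ Σ₃ (λ d → #below (λ q → p (d + q * 3)) n)
#below-*3 p zero    = refl
#below-*3 p (suc n) = begin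
  #below p (n * 3) + a 0 + a 1 + a 2 ≡⟨ cong (λ t → t + a 0 + a 1 + a 2) (#below-*3 p n) ⟩
  Σ₃ g + a 0 + a 1 + a 2             ≡⟨ +-assoc³ (Σ₃ g) (a 0) (a 1) (a 2) ⟩
  Σ₃ g + Σ₃ a                        ≡⟨ sym (Σ₃-distrib-+ g a) ⟩
  Σ₃ (λ d → g d + a d)               ∎
  where
  open ≡-Reasoning
  g a : ℕ → ℕ
  g d = #below (λ q → p (d + q * 3)) n
  a d = 𝟙 (p (d + n * 3))
  +-assoc³ : ∀ w x y z → w + x + y + z ≡ w + (x + y + z)
  +-assoc³ = solve-∀

#words : (List ℕ → Bool) → ℕ → ℕ
#words p j = countᵇ p (words j)

#words-cong : ∀ {p q} → (∀ w → p w ≡ q w) → ∀ j → #words p j ≡ #words q j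
#words-cong e j = countᵇ-cong e (words j)

#words-zero : ∀ p → #words p zero ≡ 𝟙 (p [])
#words-zero p = trans (countᵇ-∷ p [] []) (+-identityʳ _)

#words-∷ : ∀ p j → #words p (suc j) ≡ Σ₃ (λ d → #words (p ∘ (d ∷_)) j)
#words-∷ p j = go (words j)
  where
  open ≡-Reasoning
  branch : List ℕ → List (List ℕ)
  branch w = (0 ∷ w) ∷ (1 ∷ w) ∷ (2 ∷ w) ∷ []
  countᵇ-branch : ∀ w → countᵇ p (branch w) ≡ Σ₃ (λ d → 𝟙 (p (d ∷ w)))
  countᵇ-branch w
    rewrite countᵇ-∷ p (0 ∷ w) ((1 ∷ w) ∷ (2 ∷ w) ∷ [])
          | countᵇ-∷ p (1 ∷ w) ((2 ∷ w) ∷ [])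
          | countᵇ-∷ p (2 ∷ w) []
    = trans (cong (λ t → b 0 + (b 1 + t)) (+-identityʳ (b 2))) (sym (+-assoc (b 0) (b 1) (b 2)))
    where
    b : ℕ → ℕ
    b d = 𝟙 (p (d ∷ w))
  go : ∀ L → countᵇ p (concatMap branch L) ≡ Σ₃ (λ d → countᵇ (p ∘ (d ∷_)) L)
  go []      = refl
  go (w ∷ L) = begin
    countᵇ p (branch w ++ concatMap branch L)
      ≡⟨ countᵇ-++ p (branch w) _ ⟩
    countᵇ p (branch w) + countᵇ p (concatMap branch L)
      ≡⟨ cong₂ _+_ (countᵇ-branch w) (go L) ⟩
    Σ₃ (λ d → 𝟙 (p (d ∷ w))) + Σ₃ (λ d → countᵇ (p ∘ (d ∷_)) L)
      ≡⟨ sym (Σ₃-distrib-+ (λ d → 𝟙 (p (d ∷ w))) (λ d → countᵇ (p ∘ (d ∷_)) L)) ⟩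
    Σ₃ (λ d → 𝟙 (p (d ∷ w)) + countᵇ (p ∘ (d ∷_)) L)
      ≡⟨ Σ₃-cong (λ d _ → sym (countᵇ-∷ (p ∘ (d ∷_)) w L)) ⟩
    Σ₃ (λ d → countᵇ (p ∘ (d ∷_)) (w ∷ L)) ∎

#words-∷ʳ : ∀ p j → #words p (suc j) ≡ Σ₃ (λ d → #words (λ w → p (w ∷ʳ d)) j)
#words-∷ʳ p zero    = trans (#words-∷ p zero)
  (Σ₃-cong (λ d _ → trans (#words-zero (p ∘ (d ∷_))) (sym (#words-zero (λ w → p (w ∷ʳ d))))))
#words-∷ʳ p (suc j) = begin
  #words p (suc (suc j))
    ≡⟨ #words-∷ p (suc j) ⟩
  Σ₃ (λ e → #words (p ∘ (e ∷_)) (suc j))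
    ≡⟨ Σ₃-cong (λ e _ → #words-∷ʳ (p ∘ (e ∷_)) j) ⟩
  Σ₃ (λ e → Σ₃ (λ d → #words (λ w → p (e ∷ w ∷ʳ d)) j))
    ≡⟨ Σ₃-swap (λ e d → #words (λ w → p (e ∷ w ∷ʳ d)) j) ⟩
  Σ₃ (λ d → Σ₃ (λ e → #words (λ w → p (e ∷ w ∷ʳ d)) j))
    ≡⟨ Σ₃-cong (λ d _ → sym (#words-∷ (λ w → p (w ∷ʳ d)) j)) ⟩
  Σ₃ (λ d → #words (λ w → p (w ∷ʳ d)) (suc j)) ∎
  where open ≡-Reasoning

#words-reverse : ∀ p j → #words (p ∘ reverse) j ≡ #words p j
#words-reverse p zero    = trans (#words-zero (p ∘ reverse)) (sym (#words-zero p))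
#words-reverse p (suc j) = begin
  #words (p ∘ reverse) (suc j)
    ≡⟨ #words-∷ (p ∘ reverse) j ⟩
  Σ₃ (λ d → #words (λ w → p (reverse (d ∷ w))) j)
    ≡⟨ Σ₃-cong (λ d _ → #words-cong (λ w → cong p (unfold-reverse d w)) j) ⟩
  Σ₃ (λ d → #words (λ w → p (reverse w ∷ʳ d)) j)
    ≡⟨ Σ₃-cong (λ d _ → #words-reverse (λ w → p (w ∷ʳ d)) j) ⟩
  Σ₃ (λ d → #words (λ w → p (w ∷ʳ d)) j)
    ≡⟨ sym (#words-∷ʳ p j) ⟩
  #words p (suc j) ∎
  where open ≡-Reasoning

paddedDigits : ℕ → ℕ → List ℕ
paddedDigits zero    m = []
paddedDigits (suc j) m = m % 3 ∷ paddedDigits j (m / 3)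

paddedDigits-+* : ∀ j d q → d < 3 → paddedDigits (suc j) (d + q * 3) ≡ d ∷ paddedDigits j q
paddedDigits-+* j d q d<3 = cong₂ _∷_ ([m+kn]%n≡m d q 3 d<3) (cong (paddedDigits j) ([m+kn]/n≡k d q 3 d<3))

#words-paddedDigits : ∀ p j → #words p j ≡ #below (p ∘ paddedDigits j) (3 ^ j)
#words-paddedDigits p zero    = #words-zero p
#words-paddedDigits p (suc j) = begin
  #words p (suc j)
    ≡⟨ #words-∷ p j ⟩
  Σ₃ (λ d → #words (p ∘ (d ∷_)) j)
    ≡⟨ Σ₃-cong (λ d _ → #words-paddedDigits (p ∘ (d ∷_)) j) ⟩
  Σ₃ (λ d → #below (λ q → p (d ∷ paddedDigits j q)) (3 ^ j))
    ≡⟨ Σ₃-cong (λ d d<3 → #below-cong (3 ^ j) (λ q _ → cong p (sym (paddedDigits-+* j d q d<3)))) ⟩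
  Σ₃ (λ d → #below (λ q → p (paddedDigits (suc j) (d + q * 3))) (3 ^ j))
    ≡⟨ sym (#below-*3 (p ∘ paddedDigits (suc j)) (3 ^ j)) ⟩
  #below (p ∘ paddedDigits (suc j)) (3 ^ j * 3)
    ≡⟨ cong (#below (p ∘ paddedDigits (suc j))) (*-comm (3 ^ j) 3) ⟩
  #below (p ∘ paddedDigits (suc j)) (3 ^ suc j) ∎
  where open ≡-Reasoning

digitsLE-0 : ∀ f → digitsLE f 0 ≡ []
digitsLE-0 zero    = refl
digitsLE-0 (suc f) = refl

paddedDigits-0 : ∀ j → paddedDigits j 0 ≡ replicate j 0
paddedDigits-0 zero    = refl
paddedDigits-0 (suc j) = cong (0 ∷_) (paddedDigits-0 j)

length-paddedDigits : ∀ j m → length (paddedDigits j m) ≡ j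
length-paddedDigits zero    m = refl
length-paddedDigits (suc j) m = cong suc (length-paddedDigits j (m / 3))

paddedDigits≡digitsLE++0ᵏ : ∀ j f m → m ≤ f → m < 3 ^ j →
                            ∃[ k ] paddedDigits j m ≡ digitsLE f m ++ replicate k 0
paddedDigits≡digitsLE++0ᵏ j f zero _ _ =
  j , trans (paddedDigits-0 j) (cong (_++ replicate j 0) (sym (digitsLE-0 f)))
paddedDigits≡digitsLE++0ᵏ zero f (suc m) _ (s≤s ())
paddedDigits≡digitsLE++0ᵏ (suc j) zero (suc m) () _
paddedDigits≡digitsLE++0ᵏ (suc j) (suc f) (suc m) (s≤s m≤f) m<3^j =
  map₂ (cong (suc m % 3 ∷_)) (paddedDigits≡digitsLE++0ᵏ j f (suc m / 3) m/3≤f m/3<3^j)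
  where
  m/3≤f : suc m / 3 ≤ f
  m/3≤f = ≤-trans (<⇒≤pred (m/n<m (suc m) 3 (s<s z<s))) m≤f
  m/3<3^j : suc m / 3 < 3 ^ j
  m/3<3^j = m<n*o⇒m/o<n (subst (suc m <_) (*-comm 3 (3 ^ j)) m<3^j)

length-base3-≤ : ∀ N m → 0 < N → m < 3 ^ N → length (base3 m) ≤ N
length-base3-≤ N zero    0<N _      = 0<N
length-base3-≤ N (suc m) _   m<3^N
  with k , eq ← paddedDigits≡digitsLE++0ᵏ N (suc m) (suc m) ≤-refl m<3^N = begin
  length (reverse ds)                      ≡⟨ length-reverse ds ⟩
  length ds                                ≤⟨ m≤m+n _ (length (replicate k 0)) ⟩
  length ds + length (replicate k 0)       ≡⟨ sym (length-++ ds) ⟩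
  length (ds ++ replicate k 0)             ≡⟨ cong length (sym eq) ⟩
  length (paddedDigits N (suc m))          ≡⟨ length-paddedDigits N (suc m) ⟩
  N                                        ∎
  where
  open ≤-Reasoning
  ds : List ℕ
  ds = digitsLE (suc m) (suc m)

isMotzkinWord-0∷ : ∀ w → isMotzkinWord (0 ∷ w) ≡ isMotzkinWord w
isMotzkinWord-0∷ w =
  cong ((count 1 w ≡ᵇ count 2 w) ∧_) (allᵇ-map (λ p → count 2 p ≤ᵇ count 1 p) (0 ∷_) (inits w))

isMotzkinWord-0ᵏ++ : ∀ k w → isMotzkinWord (replicate k 0 ++ w) ≡ isMotzkinWord w
isMotzkinWord-0ᵏ++ zero    w = refl
isMotzkinWord-0ᵏ++ (suc k) w = trans (isMotzkinWord-0∷ (replicate k 0 ++ w)) (isMotzkinWord-0ᵏ++ k w)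

isMotzkinWord-reverse-paddedDigits : ∀ N m → m < 3 ^ N → isMotzkinWord (reverse (paddedDigits N m)) ≡ isM m
isMotzkinWord-reverse-paddedDigits N zero _ = begin
  isMotzkinWord (reverse (paddedDigits N 0))  ≡⟨ cong (isMotzkinWord ∘ reverse) (paddedDigits-0 N) ⟩
  isMotzkinWord (reverse (replicate N 0))     ≡⟨ cong isMotzkinWord (reverse-replicate N 0) ⟩
  isMotzkinWord (replicate N 0)               ≡⟨ cong isMotzkinWord (sym (++-identityʳ (replicate N 0))) ⟩
  isMotzkinWord (replicate N 0 ++ [])         ≡⟨ isMotzkinWord-0ᵏ++ N [] ⟩
  isM 0                                       ∎
  where open ≡-Reasoning
isMotzkinWord-reverse-paddedDigits N (suc m) m<3^N
  with k , eq ← paddedDigits≡digitsLE++0ᵏ N (suc m) (suc m) ≤-refl m<3^N = begin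
  isMotzkinWord (reverse (paddedDigits N (suc m)))
    ≡⟨ cong (isMotzkinWord ∘ reverse) eq ⟩
  isMotzkinWord (reverse (ds ++ replicate k 0))
    ≡⟨ cong isMotzkinWord (reverse-++ ds (replicate k 0)) ⟩
  isMotzkinWord (reverse (replicate k 0) ++ reverse ds)
    ≡⟨ cong (λ zs → isMotzkinWord (zs ++ reverse ds)) (reverse-replicate k 0) ⟩
  isMotzkinWord (replicate k 0 ++ reverse ds)
    ≡⟨ isMotzkinWord-0ᵏ++ k (reverse ds) ⟩
  isM (suc m) ∎
  where
  open ≡-Reasoning
  ds : List ℕ
  ds = digitsLE (suc m) (suc m)

motzkin≡#below : ∀ N → motzkin N ≡ #below isM (3 ^ N)
motzkin≡#below N = begin
  #words isMotzkinWord N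
    ≡⟨ sym (#words-reverse isMotzkinWord N) ⟩
  #words (isMotzkinWord ∘ reverse) N
    ≡⟨ #words-paddedDigits (isMotzkinWord ∘ reverse) N ⟩
  #below (isMotzkinWord ∘ reverse ∘ paddedDigits N) (3 ^ N)
    ≡⟨ #below-cong (3 ^ N) (isMotzkinWord-reverse-paddedDigits N) ⟩
  #below isM (3 ^ N) ∎
  where open ≡-Reasoning

digitsLE-step : ∀ {f m} → 0 < f → 0 < m → digitsLE f m ≡ m % 3 ∷ digitsLE (pred f) (m / 3)
digitsLE-step {suc f} {suc m} _ _ = refl

digitsLE-+* : ∀ f d q → 0 < f → 0 < q → d < 3 → digitsLE f (d + q * 3) ≡ d ∷ digitsLE (pred f) q
digitsLE-+* f d q 0<f 0<q d<3 = trans (digitsLE-step 0<f 0<d+q*3)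
  (cong₂ _∷_ ([m+kn]%n≡m d q 3 d<3) (cong (digitsLE (pred f)) ([m+kn]/n≡k d q 3 d<3)))
  where
  0<d+q*3 : 0 < d + q * 3
  0<d+q*3 = ≤-trans 0<q (≤-trans (m≤m*n q 3) (m≤n+m (q * 3) d))

digitsLE-3^ : ∀ K f → 3 ^ K ≤ f → digitsLE f (3 ^ K) ≡ replicate K 0 ∷ʳ 1
digitsLE-3^ zero    (suc f) _      = cong (1 ∷_) (digitsLE-0 f)
digitsLE-3^ (suc K) f       3^K≤f = begin
  digitsLE f (3 ^ suc K)        ≡⟨ cong (digitsLE f) (*-comm 3 (3 ^ K)) ⟩
  digitsLE f (0 + 3 ^ K * 3)    ≡⟨ digitsLE-+* f 0 (3 ^ K) (≤-trans (m^n>0 3 (suc K)) 3^K≤f) (m^n>0 3 K) z<s ⟩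
  0 ∷ digitsLE (pred f) (3 ^ K) ≡⟨ cong (0 ∷_) (digitsLE-3^ K (pred f) 3^K≤pred-f) ⟩
  0 ∷ replicate K 0 ∷ʳ 1        ∎
  where
  open ≡-Reasoning
  3^K≤pred-f : 3 ^ K ≤ pred f
  3^K≤pred-f = <⇒≤pred (≤-trans (3^n<3^[1+n] K) 3^K≤f)

base3-pos : ∀ {m} → 0 < m → base3 m ≡ reverse (digitsLE m m)
base3-pos {suc m} _ = refl

base3-+3^ : ∀ K d → d < 3 → base3 (d + 3 ^ suc K) ≡ 1 ∷ replicate K 0 ∷ʳ d
base3-+3^ K d d<3 = begin
  base3 n                                       ≡⟨ base3-pos 0<n ⟩
  reverse (digitsLE n n)                        ≡⟨ cong (λ m → reverse (digitsLE n m)) n≡d+3^K*3 ⟩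
  reverse (digitsLE n (d + 3 ^ K * 3))          ≡⟨ cong reverse (digitsLE-+* n d (3 ^ K) 0<n (m^n>0 3 K) d<3) ⟩
  reverse (d ∷ digitsLE (pred n) (3 ^ K))       ≡⟨ cong (λ ds → reverse (d ∷ ds)) (digitsLE-3^ K (pred n) 3^K≤pred-n) ⟩
  reverse (d ∷ replicate K 0 ∷ʳ 1)              ≡⟨ unfold-reverse d (replicate K 0 ∷ʳ 1) ⟩
  reverse (replicate K 0 ∷ʳ 1) ∷ʳ d             ≡⟨ cong (_∷ʳ d) (reverse-++ (replicate K 0) (1 ∷ [])) ⟩
  (1 ∷ reverse (replicate K 0)) ∷ʳ d            ≡⟨ cong (λ zs → 1 ∷ zs ∷ʳ d) (reverse-replicate K 0) ⟩
  1 ∷ replicate K 0 ∷ʳ d                        ∎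
  where
  open ≡-Reasoning
  n : ℕ
  n = d + 3 ^ suc K
  0<n : 0 < n
  0<n = ≤-trans (m^n>0 3 (suc K)) (m≤n+m _ d)
  n≡d+3^K*3 : n ≡ d + 3 ^ K * 3
  n≡d+3^K*3 = cong (d +_) (*-comm 3 (3 ^ K))
  3^K≤pred-n : 3 ^ K ≤ pred n
  3^K≤pred-n = <⇒≤pred (≤-trans (3^n<3^[1+n] K) (m≤n+m _ d))

count-0ᵏ++ : ∀ c k w → count (suc c) (replicate k 0 ++ w) ≡ count (suc c) w
count-0ᵏ++ c zero    w = refl
count-0ᵏ++ c (suc k) w = count-0ᵏ++ c k w

isMotzkinWord-10ᵏ0 : ∀ K → isMotzkinWord (1 ∷ replicate K 0 ∷ʳ 0) ≡ false
isMotzkinWord-10ᵏ0 K rewrite count-0ᵏ++ 0 K (0 ∷ []) | count-0ᵏ++ 1 K (0 ∷ []) = refl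

isMotzkinWord-10ᵏ1 : ∀ K → isMotzkinWord (1 ∷ replicate K 0 ∷ʳ 1) ≡ false
isMotzkinWord-10ᵏ1 K rewrite count-0ᵏ++ 0 K (1 ∷ []) | count-0ᵏ++ 1 K (1 ∷ []) = refl

inits-0ᵏ2-deficit≤1 : ∀ K → allᵇ (λ p → count 2 p ≤ᵇ suc (count 1 p)) (inits (replicate K 0 ∷ʳ 2)) ≡ true
inits-0ᵏ2-deficit≤1 zero    = refl
inits-0ᵏ2-deficit≤1 (suc K) =
  trans (allᵇ-map (λ p → count 2 p ≤ᵇ suc (count 1 p)) (0 ∷_) (inits (replicate K 0 ∷ʳ 2))) (inits-0ᵏ2-deficit≤1 K)

isMotzkinWord-10ᵏ2 : ∀ K → isMotzkinWord (1 ∷ replicate K 0 ∷ʳ 2) ≡ true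
isMotzkinWord-10ᵏ2 K = trans (cong₂ _∧_ balanced (allᵇ-map (λ p → count 2 p ≤ᵇ count 1 p) (1 ∷_) (inits w)))
                             (inits-0ᵏ2-deficit≤1 K)
  where
  w : List ℕ
  w = replicate K 0 ∷ʳ 2
  balanced : (count 1 (1 ∷ w) ≡ᵇ count 2 (1 ∷ w)) ≡ true
  balanced rewrite count-0ᵏ++ 0 K (2 ∷ []) | count-0ᵏ++ 1 K (2 ∷ []) = refl

isM-+3^ : ∀ K d → d < 3 → isM (d + 3 ^ suc K) ≡ isMotzkinWord (1 ∷ replicate K 0 ∷ʳ d)
isM-+3^ K d d<3 = cong isMotzkinWord (base3-+3^ K d d<3)

3^∉𝕄 : ∀ K → isM (3 ^ suc K) ≡ false
3^∉𝕄 K = trans (isM-+3^ K 0 z<s) (isMotzkinWord-10ᵏ0 K)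

1+3^∉𝕄 : ∀ K → isM (1 + 3 ^ suc K) ≡ false
1+3^∉𝕄 K = trans (isM-+3^ K 1 (s<s z<s)) (isMotzkinWord-10ᵏ1 K)

2+3^∈𝕄ₙ : ∀ K → InMn (2 + K) (2 + 3 ^ suc K)
2+3^∈𝕄ₙ K = trans (isM-+3^ K 2 (s<s (s<s z<s))) (isMotzkinWord-10ᵏ2 K) , (begin
  length (base3 (2 + 3 ^ suc K))         ≡⟨ cong length (base3-+3^ K 2 (s<s (s<s z<s))) ⟩
  suc (length (replicate K 0 ++ 2 ∷ [])) ≡⟨ cong suc (length-++ (replicate K 0)) ⟩
  suc (length (replicate K 0) + 1)       ≡⟨ cong (λ l → suc (l + 1)) (length-replicate K) ⟩
  suc (K + 1)                            ≡⟨ cong suc (+-comm K 1) ⟩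
  2 + K                                  ∎)
  where open ≡-Reasoning

2+3^-≤-𝕄ₙ : ∀ K k → InMn (2 + K) k → 2 + 3 ^ suc K ≤ k
2+3^-≤-𝕄ₙ K k (k∈𝕄 , k-length) =
  subst (2 + 3 ^ suc K ≤_) e+3^≡k (excess≥2 (k ∸ 3 ^ suc K) (subst InM (sym e+3^≡k) k∈𝕄))
  where
  3^≤k : 3 ^ suc K ≤ k
  3^≤k = ≮⇒≥ (λ k<3^ → 1+n≰n (subst (_≤ suc K) k-length (length-base3-≤ (suc K) k z<s k<3^)))
  e+3^≡k : k ∸ 3 ^ suc K + 3 ^ suc K ≡ k
  e+3^≡k = m∸n+n≡m 3^≤k
  excess≥2 : ∀ e → InM (e + 3 ^ suc K) → 2 + 3 ^ suc K ≤ e + 3 ^ suc K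
  excess≥2 0             e∈𝕄 with () ← trans (sym (3^∉𝕄 K)) e∈𝕄
  excess≥2 1             e∈𝕄 with () ← trans (sym (1+3^∉𝕄 K)) e∈𝕄
  excess≥2 (suc (suc e)) _   = +-monoˡ-≤ (3 ^ suc K) {2} {2 + e} (s≤s (s≤s z≤n))

index-2+3^ : ∀ K → index (2 + 3 ^ suc K) ≡ motzkin (suc K)
index-2+3^ K = begin
  index (2 + 3 ^ suc K)
    ≡⟨ countᵇ-upTo isM (2 + 3 ^ suc K) ⟩
  #below isM (3 ^ suc K) + 𝟙 (isM (3 ^ suc K)) + 𝟙 (isM (1 + 3 ^ suc K))
    ≡⟨ cong₂ (λ a b → #below isM (3 ^ suc K) + 𝟙 a + 𝟙 b) (3^∉𝕄 K) (1+3^∉𝕄 K) ⟩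
  #below isM (3 ^ suc K) + 0 + 0
    ≡⟨ trans (+-identityʳ _) (+-identityʳ _) ⟩
  #below isM (3 ^ suc K)
    ≡⟨ sym (motzkin≡#below (suc K)) ⟩
  motzkin (suc K) ∎
  where open ≡-Reasoning

mainTheorem2 : ∀ (n : ℕ) → 2 ≤ n →
    IsMinMn n (3 ^ (n ∸ 1) + 2) × index (3 ^ (n ∸ 1) + 2) ≡ motzkin (n ∸ 1)
mainTheorem2 (suc (suc K)) (s≤s (s≤s z≤n)) rewrite +-comm (3 ^ suc K) 2 =
  (2+3^∈𝕄ₙ K , 2+3^-≤-𝕄ₙ K) , index-2+3^ K
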